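{- Let $k\ge 1$ be an integer and let $\mathcal{C}$ be a valid set of cut-edges of the $n$-node cycle whose induced coloring is $1$-balanced. Then there is a deterministic procedure that computes a subset $\mathcal{C}_{2k}\subseteq \mathcal{C}$ with $|\mathcal{C}_{2k}|=\min\{2k,|\mathcal{C}|\}$ such that the coloring induced by $\mathcal{C}_{2k}$ is $(1+1/k)$-balanced.
   Context: Consider a cycle on $n$ nodes ($n$ even) with edges $(v_1,v_2),\dots,(v_{n-1},v_n),(v_n,v_1)$. A set $\mathcal{C}$ of cycle edges is valid if $|\mathcal{C}|$ is even; such a set induces a two-coloring (red/blue) of the nodes, unique up to swapping the two colors, in which the endpoints of an edge have different colors exactly when the edge belongs to $\mathcal{C}$ (the cut-edges). A coloring is $\alpha$-balanced if each color is used on at most $\alpha\cdot n/2$ nodes; this property does not depend on which of the two colorings induced by $\mathcal{C}$ is taken. -}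

module Defs where

open import Data.Bool using (Bool; true; false; not)
open import Data.Nat using (ℕ; zero; suc; _*_; _≤_; _<ᵇ_)
open import Data.Nat.Divisibility using (_∣_)
open import Data.Fin using (Fin; toℕ)
open import Data.Fin.Subset using (Subset; ∣_∣; ∁; _∩_)
open import Data.Vec using (tabulate)
open import Data.Product using (_×_)

-- Cycle on n nodes v_0,…,v_{n-1}; edge i : Fin n joins v_i and v_{(i+1) mod n}.
-- A set of cut-edges is a Subset n of the edge indices.

odd? : ℕ → Bool
odd? zero    = false
odd? (suc m) = not (odd? m)

Valid : {n : ℕ} → Subset n → Set
Valid C = 2 ∣ ∣ C ∣

-- edges i with i < j (the edges on the path v_0 … v_j)
edgesBefore : {n : ℕ} → Fin n → Subset n
edgesBefore j = tabulate (λ i → toℕ i <ᵇ toℕ j)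

-- induced coloring (normalised so that v_0 is red = false):
-- node v_j is blue (true) iff an odd number of cut-edges lie on the path v_0 … v_j.
-- For valid C this is exactly the coloring in which the endpoints of an edge
-- differ iff the edge is in C.
coloring : {n : ℕ} → Subset n → Subset n
coloring C = tabulate (λ j → odd? ∣ C ∩ edgesBefore j ∣)

-- α-balanced with α = p / q (q > 0): each colour is used on at most α·n/2 nodes,
-- i.e. 2·q·(#nodes of that colour) ≤ p·n.
Balanced : {n : ℕ} → (p q : ℕ) → Subset n → Set
Balanced {n} p q C =
  (2 * q * ∣ coloring C ∣ ≤ p * n) × (2 * q * ∣ ∁ (coloring C) ∣ ≤ p * n)

{-# OPTIONS --safe #-}
module Submission where

-- Node vⱼ is blue iff an odd number of cut edges precede it, so the cut edges split the nodes into
-- runs of one colour.  After the run of v₀ the runs have lengths x₁ y₁ … x_j y_j z w, where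
-- ∣C∣ = 2(j + 1); the xᵢ and z are blue and, C being 1-balanced, make up n/2 nodes.  Call the pair
-- (xᵢ, yᵢ) heavy if k(xᵢ + yᵢ) > n; there are fewer than k heavy pairs, so we can choose k − 1
-- pairs to keep that include all of them.  Every other pair i loses two of the three cut edges
-- around it: those before xᵢ and yᵢ if i ≤ a, which turns xᵢ red, or those before yᵢ and x_{i+1}
-- (x_{j+1} = z) if i > a, which turns yᵢ blue.  This leaves 2k cut edges.  As a runs from 0 to j
-- the number of blue nodes falls from at least n/2 to at most n/2 in steps of at most n/k, so for
-- some a it is within n/(2k) of n/2.

open import Defs
open import Data.Nat using (ℕ; _*_; _+_; _≤_; _⊓_)
open import Data.Nat.Divisibility using (_∣_)
open import Data.Fin.Subset using (Subset; ∣_∣; _⊆_)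
open import Data.Product using (Σ; _×_)
open import Relation.Binary.PropositionalEquality using (_≡_)

open import Data.Bool using (Bool; true; false; _∧_; _xor_; if_then_else_; T)
open import Data.Bool.Properties using (T?; xor-identityʳ; not-distribˡ-xor; not-distribʳ-xor)
open import Data.Empty using (⊥-elim)
import Data.Fin as Fin
open import Data.Fin.Subset using (⊥; ∁; _∩_)
open import Data.Fin.Subset.Properties using (⊆-refl; ∣⊥∣≡0; ∣∁p∣≡n∸∣p∣; ∣p∣≤n; ∩-zeroʳ)
open import Data.List using (List; []; _∷_; _++_; length; filter; map; replicate)
open import Data.List.Properties using (length-filter; filter-accept; filter-reject; length-replicate)
open import Data.List.Relation.Binary.Pointwise using (Pointwise; []; _∷_; Pointwise-length)
open import Data.Nat using (zero; suc; _<_; _≤?_; _<?_; z≤n; s≤s)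
open import Data.Nat.Divisibility using (divides)
open import Data.Nat.ListAction using (sum)
open import Data.Nat.ListAction.Properties using (sum-++)
open import Data.Nat.Properties
open import Data.Nat.Tactic.RingSolver using (solve-∀)
open import Data.Product using (∃; ∃₂; _,_)
open import Data.Vec using ([]; _∷_; tabulate; here; there)
open import Data.Vec.Properties using (tabulate-cong; tabulate∘lookup; lookup-replicate)
open import Function using (_∘_)
open import Relation.Binary.PropositionalEquality
  using (refl; sym; trans; cong; cong₂; subst; subst₂; module ≡-Reasoning)
open import Relation.Nullary using (Dec; yes; no; ¬_)
open import Relation.Unary using (Pred; Decidable)

discrete-ivt : ∀ (f : ℕ → ℕ) t d N → f N ≤ t → t ≤ f zero → (∀ a → f a ≤ f (suc a) + (d + d)) →
               ∃ λ a → f a ≤ t + d × t ≤ f a + d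
discrete-ivt f t d zero    fN≤t t≤f0 _ = zero , ≤-trans fN≤t (m≤m+n t d) , ≤-trans t≤f0 (m≤m+n _ d)
discrete-ivt f t d (suc N) fN≤t t≤f0 step with t ≤? f (suc N) + d
... | yes t≤ = suc N , ≤-trans fN≤t (m≤m+n t d) , t≤
... | no t≰ with t ≤? f N + d
...   | yes t≤ = N , fN≤t+d , t≤
  where
  fN≤t+d : f N ≤ t + d
  fN≤t+d = begin
    f N                 ≤⟨ step N ⟩
    f (suc N) + (d + d) ≡⟨ sym (+-assoc (f (suc N)) d d) ⟩
    f (suc N) + d + d   ≤⟨ +-monoˡ-≤ d (<⇒≤ (≰⇒> t≰)) ⟩
    t + d               ∎
    where open ≤-Reasoning
...   | no t≰′ = discrete-ivt f t d N (≤-trans (m≤m+n (f N) d) (<⇒≤ (≰⇒> t≰′))) t≤f0 step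

trues : List Bool → ℕ
trues μ = length (filter T? μ)

module _ {a p} {A : Set a} {P : Pred A p} (P? : Decidable P) where

  CoveringMask : ℕ → List A → Set _
  CoveringMask b xs = ∃ λ κ → trues κ ≡ b × Pointwise (λ c x → P x → T c) κ xs

  private
    keep : ∀ {b x xs} → CoveringMask b xs → CoveringMask (suc b) (x ∷ xs)
    keep (κ , trues≡b , covers) = true ∷ κ , cong suc trues≡b , (λ _ → _) ∷ covers

    skip : ∀ {b x xs} → ¬ P x → CoveringMask b xs → CoveringMask b (x ∷ xs)
    skip ¬px (κ , trues≡b , covers) = false ∷ κ , trues≡b , (λ px → ¬px px) ∷ covers

  covering-mask : ∀ b xs → length (filter P? xs) ≤ b → b ≤ length xs → CoveringMask b xs
  covering-mask b [] _ b≤0 = [] , sym (n≤0⇒n≡0 b≤0) , []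
  covering-mask b (x ∷ xs) f≤b b≤ with P? x | b ≤? length xs
  covering-mask (suc b) (x ∷ xs) (s≤s f≤b) (s≤s b≤) | yes _ | _ =
    keep (covering-mask b xs f≤b b≤)
  covering-mask b (x ∷ xs) f≤b _ | no ¬px | yes b≤ =
    skip ¬px (covering-mask b xs f≤b b≤)
  covering-mask zero (x ∷ xs) _ _ | no _ | no 0≰ =
    ⊥-elim (0≰ z≤n)
  covering-mask (suc b) (x ∷ xs) _ (s≤s b≤) | no _ | no b≰ =
    -- b = 1 + length xs, so every remaining element has to be kept
    keep (covering-mask b xs (≤-trans (length-filter P? xs) (≤-pred (≰⇒> b≰))) b≤)

coloringFrom : ∀ {n} → Bool → Subset n → Subset n
coloringFrom p C = tabulate (λ j → p xor odd? ∣ C ∩ edgesBefore j ∣)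

edgesBefore-zero : ∀ {n} → edgesBefore {suc n} Fin.zero ≡ ⊥
edgesBefore-zero = trans (tabulate-cong (λ i → sym (lookup-replicate i false))) (tabulate∘lookup ⊥)

coloringFrom-∷ : ∀ {n} p c (C : Subset n) → coloringFrom p (c ∷ C) ≡ p ∷ coloringFrom (c xor p) C
coloringFrom-∷ {n} p c C = cong₂ _∷_ first (tabulate-cong (λ j → rest c (C ∩ edgesBefore j)))
  where
  first : p xor odd? ∣ (c ∷ C) ∩ edgesBefore Fin.zero ∣ ≡ p
  first = begin
    p xor odd? ∣ (c ∷ C) ∩ edgesBefore Fin.zero ∣
      ≡⟨ cong (λ E → p xor odd? ∣ (c ∷ C) ∩ E ∣) edgesBefore-zero ⟩
    p xor odd? ∣ (c ∷ C) ∩ ⊥ ∣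
      ≡⟨ cong (λ E → p xor odd? ∣ E ∣) (∩-zeroʳ (c ∷ C)) ⟩
    p xor odd? ∣ ⊥ {n = suc n} ∣
      ≡⟨ cong (λ m → p xor odd? m) (∣⊥∣≡0 (suc n)) ⟩
    p xor false
      ≡⟨ xor-identityʳ p ⟩
    p ∎
    where open ≡-Reasoning
  rest : ∀ {m} c (V : Subset m) → p xor odd? ∣ (c ∧ true) ∷ V ∣ ≡ (c xor p) xor odd? ∣ V ∣
  rest true  V = trans (sym (not-distribʳ-xor p _)) (not-distribˡ-xor p _)
  rest false V = refl

∣p∣+∣∁p∣≡n : ∀ {n} (p : Subset n) → ∣ p ∣ + ∣ ∁ p ∣ ≡ n
∣p∣+∣∁p∣≡n p = trans (cong (∣ p ∣ +_) (∣∁p∣≡n∸∣p∣ p)) (m+[n∸m]≡n (∣p∣≤n p))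

Balanced-1-1⇒half : ∀ {n} (C : Subset n) → Balanced 1 1 C → n ≡ ∣ coloring C ∣ + ∣ coloring C ∣
Balanced-1-1⇒half {n} C (2x≤n , 2y≤n) = begin-equality
  n     ≡⟨ sym x+y≡n ⟩
  x + y ≡⟨ cong (x +_) (≤-antisym (half≤ (trans (+-comm y x) x+y≡n) 2y≤n) (half≤ x+y≡n 2x≤n)) ⟩
  x + x ∎
  where
  open ≤-Reasoning
  x = ∣ coloring C ∣
  y = ∣ ∁ (coloring C) ∣
  x+y≡n : x + y ≡ n
  x+y≡n = ∣p∣+∣∁p∣≡n (coloring C)
  double : ∀ u → u + u ≡ 2 * 1 * u
  double = solve-∀
  half≤ : ∀ {u v} → u + v ≡ n → 2 * 1 * u ≤ 1 * n → u ≤ v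
  half≤ {u} {v} u+v≡n 2u≤n = +-cancelˡ-≤ u u v (begin
    u + u     ≡⟨ double u ⟩
    2 * 1 * u ≤⟨ 2u≤n ⟩
    1 * n     ≡⟨ *-identityˡ n ⟩
    n         ≡⟨ sym u+v≡n ⟩
    u + v     ∎)

near-half⇒Balanced : ∀ {n} k H (C : Subset n) → n ≡ H + H →
  k * ∣ coloring C ∣ ≤ k * H + H → k * H ≤ k * ∣ coloring C ∣ + H → Balanced (k + 1) k C
near-half⇒Balanced {n} k H C n≡2H x-above x-below = scaled x-above , scaled y-above
  where
  open ≤-Reasoning
  x = ∣ coloring C ∣
  y = ∣ ∁ (coloring C) ∣
  scaled : ∀ {z} → k * z ≤ k * H + H → 2 * k * z ≤ (k + 1) * n
  scaled {z} kz≤ = begin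
    2 * k * z                   ≡⟨ e₁ k z ⟩
    k * z + k * z               ≤⟨ +-mono-≤ kz≤ kz≤ ⟩
    (k * H + H) + (k * H + H)   ≡⟨ e₂ k H ⟩
    (k + 1) * (H + H)           ≡⟨ cong ((k + 1) *_) (sym n≡2H) ⟩
    (k + 1) * n                 ∎
    where
    e₁ : ∀ k z → 2 * k * z ≡ k * z + k * z
    e₁ = solve-∀
    e₂ : ∀ k H → (k * H + H) + (k * H + H) ≡ (k + 1) * (H + H)
    e₂ = solve-∀
  y-above : k * y ≤ k * H + H
  y-above = +-cancelʳ-≤ (k * H) (k * y) (k * H + H) (begin
    k * y + k * H       ≤⟨ +-monoʳ-≤ (k * y) x-below ⟩
    k * y + (k * x + H) ≡⟨ e₃ k x y H ⟩
    k * (x + y) + H     ≡⟨ cong (λ m → k * m + H) (trans (∣p∣+∣∁p∣≡n (coloring C)) n≡2H) ⟩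
    k * (H + H) + H     ≡⟨ e₄ k H ⟩
    (k * H + H) + k * H ∎)
    where
    e₃ : ∀ k x y H → k * y + (k * x + H) ≡ k * (x + y) + H
    e₃ = solve-∀
    e₄ : ∀ k H → k * (H + H) + H ≡ (k * H + H) + k * H
    e₄ = solve-∀

restrict : ∀ {n} → List Bool → Subset n → Subset n
restrict μ       []          = []
restrict μ       (false ∷ C) = false ∷ restrict μ C
restrict []      (true ∷ C)  = false ∷ restrict [] C
restrict (b ∷ μ) (true ∷ C)  = b ∷ restrict μ C

restrict-⊆ : ∀ {n} μ (C : Subset n) → restrict μ C ⊆ C
restrict-⊆ μ       (false ∷ C) (there i) = there (restrict-⊆ μ C i)
restrict-⊆ []      (true ∷ C)  (there i) = there (restrict-⊆ [] C i)
restrict-⊆ (b ∷ μ) (true ∷ C)  here      = here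
restrict-⊆ (b ∷ μ) (true ∷ C)  (there i) = there (restrict-⊆ μ C i)

∣restrict∣ : ∀ {n} μ (C : Subset n) → length μ ≡ ∣ C ∣ → ∣ restrict μ C ∣ ≡ trues μ
∣restrict∣ []          []          _  = refl
∣restrict∣ μ           (false ∷ C) eq = ∣restrict∣ μ C eq
∣restrict∣ (true ∷ μ)  (true ∷ C)  eq = cong suc (∣restrict∣ μ C (suc-injective eq))
∣restrict∣ (false ∷ μ) (true ∷ C)  eq = ∣restrict∣ μ C (suc-injective eq)

restrict-replicate : ∀ {n} (C : Subset n) → restrict (replicate ∣ C ∣ true) C ≡ C
restrict-replicate []          = refl
restrict-replicate (false ∷ C) = cong (false ∷_) (restrict-replicate C)
restrict-replicate (true ∷ C)  = cong (true ∷_) (restrict-replicate C)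

-- The run after cut edge i starts at v_{i+1}; laterRuns lists these run lengths in order.
firstRun : ∀ {n} → Subset n → ℕ
firstRun []          = 0
firstRun (false ∷ C) = suc (firstRun C)
firstRun (true ∷ C)  = 1

laterRuns : ∀ {n} → Subset n → List ℕ
laterRuns []          = []
laterRuns (false ∷ C) = laterRuns C
laterRuns (true ∷ C)  = firstRun C ∷ laterRuns C

length-laterRuns : ∀ {n} (C : Subset n) → length (laterRuns C) ≡ ∣ C ∣
length-laterRuns []          = refl
length-laterRuns (false ∷ C) = length-laterRuns C
length-laterRuns (true ∷ C)  = cong suc (length-laterRuns C)

sum-runs : ∀ {n} (C : Subset n) → firstRun C + sum (laterRuns C) ≡ n
sum-runs []          = refl
sum-runs (false ∷ C) = cong suc (sum-runs C)
sum-runs (true ∷ C)  = cong suc (sum-runs C)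

blueRuns : Bool → List Bool → List ℕ → ℕ
blueRuns p (c ∷ μ) (ℓ ∷ ls) = (if c xor p then ℓ else 0) + blueRuns (c xor p) μ ls
blueRuns _ _       _        = 0

blueRuns-∷ : ∀ {p p′ c c′} μ ls → c xor p ≡ c′ xor p′ →
             blueRuns p (c ∷ μ) ls ≡ blueRuns p′ (c′ ∷ μ) ls
blueRuns-∷ μ []       _  = refl
blueRuns-∷ μ (ℓ ∷ ls) eq = cong (λ q → (if q then ℓ else 0) + blueRuns q μ ls) eq

∣coloringFrom-restrict∣ : ∀ {n} p μ (C : Subset n) → length μ ≡ ∣ C ∣ →
  ∣ coloringFrom p (restrict μ C) ∣ ≡ (if p then firstRun C else 0) + blueRuns p μ (laterRuns C)
∣coloringFrom-restrict∣ false [] [] _ = refl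
∣coloringFrom-restrict∣ true  [] [] _ = refl
∣coloringFrom-restrict∣ true μ (false ∷ C) eq =
  trans (cong ∣_∣ (coloringFrom-∷ true false (restrict μ C)))
        (cong suc (∣coloringFrom-restrict∣ true μ C eq))
∣coloringFrom-restrict∣ false μ (false ∷ C) eq =
  trans (cong ∣_∣ (coloringFrom-∷ false false (restrict μ C)))
        (∣coloringFrom-restrict∣ false μ C eq)
∣coloringFrom-restrict∣ true (b ∷ μ) (true ∷ C) eq =
  trans (cong ∣_∣ (coloringFrom-∷ true b (restrict μ C)))
        (cong suc (∣coloringFrom-restrict∣ (b xor true) μ C (suc-injective eq)))
∣coloringFrom-restrict∣ false (b ∷ μ) (true ∷ C) eq =
  trans (cong ∣_∣ (coloringFrom-∷ false b (restrict μ C)))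
        (∣coloringFrom-restrict∣ (b xor false) μ C (suc-injective eq))

flatten : ∀ {A : Set} → List (A × A) → List A
flatten []             = []
flatten ((x , y) ∷ ps) = x ∷ y ∷ flatten ps

unflatten : ∀ {A : Set} j (xs : List A) → j * 2 ≤ length xs →
            ∃₂ λ ps tl → length ps ≡ j × xs ≡ flatten ps ++ tl
unflatten zero    xs           _               = [] , xs , refl , refl
unflatten (suc j) (x ∷ y ∷ xs) (s≤s (s≤s j2≤)) =
  let ps , tl , ∣ps∣≡j , xs≡ = unflatten j xs j2≤
  in (x , y) ∷ ps , tl , cong suc ∣ps∣≡j , cong (λ zs → x ∷ y ∷ zs) xs≡

weight : ℕ × ℕ → ℕ
weight (x , y) = x + y

sum-flatten : ∀ ps → sum (flatten ps) ≡ sum (map weight ps)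
sum-flatten []             = refl
sum-flatten ((x , y) ∷ ps) = trans (cong (λ s → x + (y + s)) (sum-flatten ps)) (sym (+-assoc x y _))

Heavy : ℕ → ℕ → Pred (ℕ × ℕ) _
Heavy k n p = n < k * weight p

heavy? : ∀ k n → Decidable (Heavy k n)
heavy? k n p = n <? k * weight p

heavy-count-bound : ∀ k n ps → length (filter (heavy? k n) ps) * suc n ≤ k * sum (map weight ps)
heavy-count-bound k n []       = z≤n
heavy-count-bound k n (p ∷ ps) = begin
  #heavy (p ∷ ps) * suc n                ≤⟨ count-head (heavy? k n p) ⟩
  k * weight p + k * sum (map weight ps) ≡⟨ sym (*-distribˡ-+ k _ _) ⟩
  k * (weight p + sum (map weight ps))   ∎
  where
  open ≤-Reasoning
  #heavy : List (ℕ × ℕ) → ℕ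
  #heavy qs = length (filter (heavy? k n) qs)
  count-head : Dec (Heavy k n p) → #heavy (p ∷ ps) * suc n ≤ k * weight p + k * sum (map weight ps)
  count-head (yes heavy) = begin
    #heavy (p ∷ ps) * suc n                ≡⟨ cong (λ l → length l * suc n) (filter-accept (heavy? k n) heavy) ⟩
    suc n + #heavy ps * suc n              ≤⟨ +-mono-≤ heavy (heavy-count-bound k n ps) ⟩
    k * weight p + k * sum (map weight ps) ∎
  count-head (no light)  = begin
    #heavy (p ∷ ps) * suc n                ≡⟨ cong (λ l → length l * suc n) (filter-reject (heavy? k n) light) ⟩
    #heavy ps * suc n                      ≤⟨ heavy-count-bound k n ps ⟩
    k * sum (map weight ps)                ≤⟨ m≤n+m _ _ ⟩
    k * weight p + k * sum (map weight ps) ∎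

heavy-count≤ : ∀ b n ps → sum (map weight ps) ≤ n → length (filter (heavy? (suc b) n) ps) ≤ b
heavy-count≤ b n ps total≤n = ≤-pred (*-cancelʳ-< (suc n) _ (suc b) (begin-strict
  length (filter (heavy? (suc b) n) ps) * suc n ≤⟨ heavy-count-bound (suc b) n ps ⟩
  suc b * sum (map weight ps)                   ≤⟨ *-monoʳ-≤ (suc b) total≤n ⟩
  suc b * n                                     <⟨ *-monoʳ-< (suc b) (n<1+n n) ⟩
  suc b * suc n                                 ∎))
  where open ≤-Reasoning

pairedCuts : List Bool → List Bool
pairedCuts []      = true ∷ []
pairedCuts (c ∷ κ) = c ∷ c ∷ pairedCuts κ

-- Masks on the cut edges before x₁ y₁ … x_j y_j z w: κᵢ decides the cut edges before xᵢ and yᵢ if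
-- i ≤ a, those before yᵢ and x_{i+1} if i > a; the cut edges before x_{a+1} and w are always kept.
slide : ℕ → List Bool → List Bool
slide zero    κ       = true ∷ pairedCuts κ
slide (suc a) []      = slide zero []
slide (suc a) (c ∷ κ) = c ∷ c ∷ slide a κ

length-slide : ∀ a κ → length (slide a κ) ≡ suc (length κ) * 2
length-slide zero    κ       = cong suc (length-pairedCuts κ)
  where
  length-pairedCuts : ∀ κ → length (pairedCuts κ) ≡ suc (length κ * 2)
  length-pairedCuts []      = refl
  length-pairedCuts (c ∷ κ) = cong (λ m → suc (suc m)) (length-pairedCuts κ)
length-slide (suc a) []      = refl
length-slide (suc a) (c ∷ κ) = cong (λ m → suc (suc m)) (length-slide a κ)

trues-slide : ∀ a κ → trues (slide a κ) ≡ suc (trues κ) * 2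
trues-slide zero    κ           = cong suc (trues-pairedCuts κ)
  where
  trues-pairedCuts : ∀ κ → trues (pairedCuts κ) ≡ suc (trues κ * 2)
  trues-pairedCuts []          = refl
  trues-pairedCuts (true ∷ κ)  = cong (λ m → suc (suc m)) (trues-pairedCuts κ)
  trues-pairedCuts (false ∷ κ) = trues-pairedCuts κ
trues-slide (suc a) []          = refl
trues-slide (suc a) (true ∷ κ)  = cong (λ m → suc (suc m)) (trues-slide a κ)
trues-slide (suc a) (false ∷ κ) = trues-slide a κ

slide-replicate : ∀ j → slide zero (replicate j true) ≡ replicate (suc j * 2) true
slide-replicate zero    = refl
slide-replicate (suc j) = cong (λ μ → true ∷ true ∷ μ) (slide-replicate j)

slideBlue : List (ℕ × ℕ) → List ℕ → List Bool → ℕ → ℕ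
slideBlue ps tl κ a = blueRuns false (slide a κ) (flatten ps ++ tl)

fullBlue : List (ℕ × ℕ) → List ℕ → ℕ
fullBlue ps tl = slideBlue ps tl (replicate (length ps) true) zero

-- Moving a past a dropped pair turns x_{a+1} and y_{a+1} from blue to red, past a kept one it
-- changes nothing.
slide-step : ∀ k n {κ ps} tl → Pointwise (λ c p → Heavy k n p → T c) κ ps →
             ∀ a → k * slideBlue ps tl κ a ≤ k * slideBlue ps tl κ (suc a) + n
slide-step k n tl [] zero    = m≤m+n _ n
slide-step k n tl [] (suc a) = m≤m+n _ n
slide-step k n {true ∷ κ}  tl (_ ∷ _) zero = m≤m+n _ n
slide-step k n {false ∷ κ} {(x , y) ∷ ps} tl (heavy⇒kept ∷ _) zero = begin
  k * (x + (y + blueRuns true (false ∷ P) R)) ≡⟨ expand k x y _ ⟩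
  k * (x + y) + k * blueRuns true (false ∷ P) R ≤⟨ +-monoˡ-≤ _ (≮⇒≥ heavy⇒kept) ⟩
  n + k * blueRuns true (false ∷ P) R          ≡⟨ +-comm n _ ⟩
  k * blueRuns true (false ∷ P) R + n          ≡⟨ cong (λ B → k * B + n) (blueRuns-∷ P R refl) ⟩
  k * blueRuns false (true ∷ P) R + n          ∎
  where
  open ≤-Reasoning
  P = pairedCuts κ
  R = flatten ps ++ tl
  expand : ∀ k x y B → k * (x + (y + B)) ≡ k * (x + y) + k * B
  expand = solve-∀
slide-step k n {true ∷ κ} {(x , y) ∷ ps} tl (_ ∷ kept) (suc a) = begin
  k * (x + slideBlue ps tl κ a)            ≡⟨ *-distribˡ-+ k x _ ⟩
  k * x + k * slideBlue ps tl κ a          ≤⟨ +-monoʳ-≤ (k * x) (slide-step k n tl kept a) ⟩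
  k * x + (k * slideBlue ps tl κ (suc a) + n) ≡⟨ sym (+-assoc (k * x) _ n) ⟩
  k * x + k * slideBlue ps tl κ (suc a) + n  ≡⟨ cong (_+ n) (sym (*-distribˡ-+ k x _)) ⟩
  k * (x + slideBlue ps tl κ (suc a)) + n  ∎
  where open ≤-Reasoning
slide-step k n {false ∷ κ} tl (_ ∷ kept) (suc a) = slide-step k n tl kept a

slide-start : ∀ κ ps tl → length κ ≡ length ps →
              slideBlue ps tl (replicate (length ps) true) zero ≤ slideBlue ps tl κ zero
slide-start []          []             tl _  = ≤-refl
slide-start (true ∷ κ)  ((x , y) ∷ ps) tl eq = +-monoʳ-≤ x (slide-start κ ps tl (suc-injective eq))
slide-start (false ∷ κ) ((x , y) ∷ ps) tl eq = +-monoʳ-≤ x (begin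
  slideBlue ps tl (replicate (length ps) true) zero ≤⟨ slide-start κ ps tl (suc-injective eq) ⟩
  blueRuns false (true ∷ pairedCuts κ) R            ≡⟨ blueRuns-∷ (pairedCuts κ) R refl ⟩
  blueRuns true (false ∷ pairedCuts κ) R            ≤⟨ m≤n+m _ y ⟩
  y + blueRuns true (false ∷ pairedCuts κ) R        ∎)
  where
  open ≤-Reasoning
  R = flatten ps ++ tl

slide-end : ∀ κ ps tl → length κ ≡ length ps →
            slideBlue ps tl κ (length κ) ≤ slideBlue ps tl (replicate (length ps) true) zero
slide-end []          []             tl _  = ≤-refl
slide-end (true ∷ κ)  ((x , y) ∷ ps) tl eq = +-monoʳ-≤ x (slide-end κ ps tl (suc-injective eq))
slide-end (false ∷ κ) ((x , y) ∷ ps) tl eq = ≤-trans (slide-end κ ps tl (suc-injective eq)) (m≤n+m _ x)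

∃-slide-near-half : ∀ b ps tl → sum (map weight ps) ≤ fullBlue ps tl + fullBlue ps tl → b ≤ length ps →
  ∃₂ λ κ a → length κ ≡ length ps × trues κ ≡ b ×
             suc b * slideBlue ps tl κ a ≤ suc b * fullBlue ps tl + fullBlue ps tl ×
             suc b * fullBlue ps tl ≤ suc b * slideBlue ps tl κ a + fullBlue ps tl
∃-slide-near-half b ps tl total≤ b≤ =
  let H = fullBlue ps tl
      κ , trues≡b , heavy⇒kept =
        covering-mask (heavy? (suc b) (H + H)) b ps (heavy-count≤ b (H + H) ps total≤) b≤
      ∣κ∣≡ = Pointwise-length heavy⇒kept
      a , above , below = discrete-ivt (λ a → suc b * slideBlue ps tl κ a) (suc b * H) H (length κ)
                            (*-monoʳ-≤ (suc b) (slide-end κ ps tl ∣κ∣≡))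
                            (*-monoʳ-≤ (suc b) (slide-start κ ps tl ∣κ∣≡))
                            (slide-step (suc b) (H + H) tl heavy⇒kept)
  in κ , a , ∣κ∣≡ , trues≡b , above , below

even⇒≡[1+j]*2 : ∀ b m → 2 ∣ m → 2 * suc b ≤ m → ∃ λ j → m ≡ suc j * 2 × b ≤ j
even⇒≡[1+j]*2 b m (divides zero m≡0) 2k≤m with () ← subst (2 * suc b ≤_) m≡0 2k≤m
even⇒≡[1+j]*2 b m (divides (suc j) m≡) 2k≤m =
  j , m≡ , ≤-pred (*-cancelʳ-≤ (suc b) (suc j) 2 (subst₂ _≤_ (*-comm 2 (suc b)) m≡ 2k≤m))

module PairedRuns {n} (C : Subset n) (ps : List (ℕ × ℕ)) (tl : List ℕ)
         (runs≡ : laterRuns C ≡ flatten ps ++ tl) (∣C∣≡ : ∣ C ∣ ≡ suc (length ps) * 2) where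

  ∣coloring-restrict∣ : ∀ μ → length μ ≡ ∣ C ∣ →
                        ∣ coloring (restrict μ C) ∣ ≡ blueRuns false μ (flatten ps ++ tl)
  ∣coloring-restrict∣ μ eq = trans (∣coloringFrom-restrict∣ false μ C eq) (cong (blueRuns false μ) runs≡)

  ∣coloring∣≡fullBlue : ∣ coloring C ∣ ≡ fullBlue ps tl
  ∣coloring∣≡fullBlue = begin
    ∣ coloring C ∣
      ≡⟨ cong (∣_∣ ∘ coloring) (sym (restrict-replicate C)) ⟩
    ∣ coloring (restrict (replicate ∣ C ∣ true) C) ∣
      ≡⟨ ∣coloring-restrict∣ _ (length-replicate ∣ C ∣) ⟩
    blueRuns false (replicate ∣ C ∣ true) (flatten ps ++ tl)
      ≡⟨ cong (λ μ → blueRuns false μ (flatten ps ++ tl)) full≡ ⟩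
    fullBlue ps tl ∎
    where
    open ≡-Reasoning
    full≡ : replicate ∣ C ∣ true ≡ slide zero (replicate (length ps) true)
    full≡ = trans (cong (λ m → replicate m true) ∣C∣≡) (sym (slide-replicate (length ps)))

  total-weight : sum (map weight ps) ≤ n
  total-weight = begin
    sum (map weight ps)           ≡⟨ sym (sum-flatten ps) ⟩
    sum (flatten ps)              ≤⟨ m≤m+n _ _ ⟩
    sum (flatten ps) + sum tl     ≡⟨ sym (sum-++ (flatten ps) tl) ⟩
    sum (flatten ps ++ tl)        ≡⟨ cong sum (sym runs≡) ⟩
    sum (laterRuns C)             ≤⟨ m≤n+m _ _ ⟩
    firstRun C + sum (laterRuns C) ≡⟨ sum-runs C ⟩
    n                             ∎
    where open ≤-Reasoning

  length-slide≡∣C∣ : ∀ a κ → length κ ≡ length ps → length (slide a κ) ≡ ∣ C ∣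
  length-slide≡∣C∣ a κ ∣κ∣≡ = trans (length-slide a κ) (trans (cong (λ m → suc m * 2) ∣κ∣≡) (sym ∣C∣≡))

  ∃-balanced-slide : ∀ b → b ≤ length ps → Balanced 1 1 C →
    Σ (Subset n) (λ C′ → C′ ⊆ C × ∣ C′ ∣ ≡ 2 * suc b × Balanced (suc b + 1) (suc b) C′)
  ∃-balanced-slide b b≤ balanced =
    let half = trans (Balanced-1-1⇒half C balanced) (cong₂ _+_ ∣coloring∣≡fullBlue ∣coloring∣≡fullBlue)
        κ , a , ∣κ∣≡ , trues≡b , above , below =
          ∃-slide-near-half b ps tl (subst (sum (map weight ps) ≤_) half total-weight) b≤
        ∣slide∣≡ = length-slide≡∣C∣ a κ ∣κ∣≡
        blue≡ = ∣coloring-restrict∣ (slide a κ) ∣slide∣≡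
    in restrict (slide a κ) C
     , restrict-⊆ (slide a κ) C
     , trans (∣restrict∣ (slide a κ) C ∣slide∣≡)
             (trans (trues-slide a κ) (trans (cong (λ m → suc m * 2) trues≡b) (*-comm (suc b) 2)))
     , near-half⇒Balanced (suc b) (fullBlue ps tl) (restrict (slide a κ) C) half
         (subst (λ B → suc b * B ≤ _) (sym blue≡) above)
         (subst (λ B → _ ≤ suc b * B + _) (sym blue≡) below)

∃-balanced-restriction : ∀ {n} b (C : Subset n) → Valid C → 2 * suc b ≤ ∣ C ∣ → Balanced 1 1 C →
  Σ (Subset n) (λ C′ → C′ ⊆ C × ∣ C′ ∣ ≡ 2 * suc b × Balanced (suc b + 1) (suc b) C′)
∃-balanced-restriction b C valid 2k≤∣C∣ =
  let j , ∣C∣≡ , b≤j = even⇒≡[1+j]*2 b ∣ C ∣ valid 2k≤∣C∣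
      j*2≤ = ≤-trans (m≤n+m (j * 2) 2) (≤-reflexive (trans (sym ∣C∣≡) (sym (length-laterRuns C))))
      ps , tl , ∣ps∣≡j , runs≡ = unflatten j (laterRuns C) j*2≤
  in PairedRuns.∃-balanced-slide C ps tl runs≡ (trans ∣C∣≡ (cong (λ m → suc m * 2) (sym ∣ps∣≡j)))
                                 b (subst (b ≤_) (sym ∣ps∣≡j) b≤j)

lemma1 : (n k : ℕ) → 2 ∣ n → 1 ≤ k → (C : Subset n) → Valid C → Balanced 1 1 C →
         Σ (Subset n) (λ C₂ₖ → (C₂ₖ ⊆ C) × (∣ C₂ₖ ∣ ≡ (2 * k) ⊓ ∣ C ∣) × Balanced (k + 1) k C₂ₖ)
lemma1 n (suc b) _ (s≤s z≤n) C valid balanced with 2 * suc b ≤? ∣ C ∣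
... | yes 2k≤∣C∣ =
  let C′ , C′⊆C , ∣C′∣≡ , C′-balanced = ∃-balanced-restriction b C valid 2k≤∣C∣ balanced
  in C′ , C′⊆C , trans ∣C′∣≡ (sym (m≤n⇒m⊓n≡m 2k≤∣C∣)) , C′-balanced
... | no 2k≰∣C∣ =
  C , ⊆-refl , sym (m≥n⇒m⊓n≡n (<⇒≤ (≰⇒> 2k≰∣C∣))) ,
  near-half⇒Balanced (suc b) ∣ coloring C ∣ C (Balanced-1-1⇒half C balanced) (m≤m+n _ _) (m≤m+n _ _)
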